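{- Let $f$ be a pure-up $\mathrm{EO}$ signature of arity $2d\geq2$ and let $x,y$ be two distinct variables of $f$. Then the signature $f^{x=0,y=1}$ of arity $2d-2$, obtained from $f$ by fixing $x=0$ and $y=1$, is pure-up. (Equivalently, pure-up signatures are closed under adding a self-loop via the pinning signature $\neq_2^{0,1}$.)
   Context: Signatures are functions $\{0,1\}^r\to\mathbb{C}$; $\mathrm{su}(f)$ is the set of inputs where $f\neq0$. An $\mathrm{EO}$ signature has even arity and support consisting only of strings with equally many 0's and 1's. $\mathrm{Span}(f)$ is the affine span over $\mathbb{F}_2$ of $\mathrm{su}(f)$ (empty if $f\equiv0$). An $\mathrm{EO}$ signature $f$ is pure-up if every string in $\mathrm{Span}(f)$ has at least as many 1's as 0's. $\neq_2^{0,1}$ is the binary signature with value $1$ at exactly one of the inputs $01,10$ and $0$ elsewhere; connecting two variables of $f$ to it fixes one of them to 0 and the other to 1. -}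

module Defs where

open import Data.Bool using (Bool; true; false; not; _xor_)
open import Data.Nat using (ℕ; zero; suc; _≤_; _%_)
open import Data.Fin using (Fin; punchOut)
open import Data.Vec using (Vec; []; _∷_; zipWith; replicate; insertAt)
open import Data.List using (List; length; foldr)
open import Data.List.Relation.Unary.All using (All)
open import Data.Product using (_×_; Σ; ∃)
open import Relation.Binary.PropositionalEquality using (_≡_; _≢_)
open import Relation.Nullary using (¬_)

ones : ∀ {n} → Vec Bool n → ℕ
ones []          = zero
ones (true ∷ v)  = suc (ones v)
ones (false ∷ v) = ones v

zeros : ∀ {n} → Vec Bool n → ℕ
zeros []          = zero
zeros (false ∷ v) = suc (zeros v)
zeros (true ∷ v)  = zeros v

-- A signature of arity r with values in C (the paper takes C = ℂ; only
-- the zero element of C matters for every notion used here).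
Sig : (C : Set) → ℕ → Set
Sig C r = Vec Bool r → C

module _ {C : Set} (0C : C) where

  InSupport : ∀ {r} → Sig C r → Vec Bool r → Set
  InSupport f s = ¬ (f s ≡ 0C)

  xorSum : ∀ {r} → List (Vec Bool r) → Vec Bool r
  xorSum = foldr (zipWith _xor_) (replicate _ false)

  -- s ∈ Span(f): s is an affine F₂-combination of elements of su(f),
  -- i.e. the sum of an odd number of (not necessarily distinct) elements
  -- of su(f).  Empty if su(f) is empty.
  InSpan : ∀ {r} → Sig C r → Vec Bool r → Set
  InSpan f s = Σ (List (Vec Bool _)) λ ss →
      All (InSupport f) ss × (length ss % 2 ≡ 1) × (xorSum ss ≡ s)

  IsEO : ∀ {r} → Sig C r → Set
  IsEO {r} f = (r % 2 ≡ 0) × (∀ s → InSupport f s → ones s ≡ zeros s)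

  IsPureUp : ∀ {r} → Sig C r → Set
  IsPureUp f = IsEO f × (∀ s → InSpan f s → zeros s ≤ ones s)

-- f^{x=0,y=1}: fix variable x to 0 and variable y (≠ x) to 1.
-- An input u of arity m is extended by inserting 1 at the position of y
-- among the variables other than x, then 0 at position x.
pin : ∀ {C : Set} {m} → Sig C (suc (suc m)) → (x y : Fin (suc (suc m))) →
      x ≢ y → Sig C m
pin f x y x≢y u = f (insertAt (insertAt u (punchOut x≢y) true) x false)

{-# OPTIONS --safe #-}
-- Fixing x = 0 and y = 1 precomposes f with the map u ↦ u[y:=1][x:=0], which
-- adds one 1 and one 0 to every string and commutes with sums of an odd number
-- of strings (the inserted bits are constant).  Hence su(f^{x=0,y=1}) and
-- Span(f^{x=0,y=1}) embed into su(f) and Span(f) with the difference between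
-- the numbers of 1's and 0's unchanged, so balance and pure-upness transfer.
module Submission where

open import Defs
open import Data.Bool using (Bool; true; false; _xor_)
open import Data.Bool.Properties using (xor-same; xor-identityʳ)
open import Data.Nat using (ℕ; suc; _%_; _≤_; s≤s⁻¹)
open import Data.Nat.Properties using (suc-injective)
open import Data.Fin using (Fin; punchOut)
open import Data.Vec using (Vec; _∷_; zipWith; replicate; insertAt)
open import Data.List using (length; map) renaming ([] to []ˡ; _∷_ to _∷ˡ_)
open import Data.List.Properties using (length-map; map-∘)
open import Data.List.Relation.Unary.All.Properties using (map⁺)
open import Data.Product using (_,_)
open import Function using (_∘_)
open import Relation.Binary.PropositionalEquality
  using (_≡_; _≢_; refl; cong; trans; sym; subst₂; module ≡-Reasoning)

private
  variable
    A : Set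
    n : ℕ

ones-insertAt : ∀ (v : Vec Bool n) i b → ones (insertAt v i b) ≡ ones (b ∷ v)
ones-insertAt v           Fin.zero    b     = refl
ones-insertAt (true ∷ v)  (Fin.suc i) true  = cong suc (ones-insertAt v i true)
ones-insertAt (true ∷ v)  (Fin.suc i) false = cong suc (ones-insertAt v i false)
ones-insertAt (false ∷ v) (Fin.suc i) true  = ones-insertAt v i true
ones-insertAt (false ∷ v) (Fin.suc i) false = ones-insertAt v i false

zeros-insertAt : ∀ (v : Vec Bool n) i b → zeros (insertAt v i b) ≡ zeros (b ∷ v)
zeros-insertAt v           Fin.zero    b     = refl
zeros-insertAt (false ∷ v) (Fin.suc i) true  = cong suc (zeros-insertAt v i true)
zeros-insertAt (false ∷ v) (Fin.suc i) false = cong suc (zeros-insertAt v i false)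
zeros-insertAt (true ∷ v)  (Fin.suc i) true  = zeros-insertAt v i true
zeros-insertAt (true ∷ v)  (Fin.suc i) false = zeros-insertAt v i false

zipWith-insertAt : ∀ (_∙_ : A → A → A) (u v : Vec A n) i a b →
  zipWith _∙_ (insertAt u i a) (insertAt v i b) ≡ insertAt (zipWith _∙_ u v) i (a ∙ b)
zipWith-insertAt _∙_ u       v       Fin.zero    a b = refl
zipWith-insertAt _∙_ (c ∷ u) (d ∷ v) (Fin.suc i) a b =
  cong ((c ∙ d) ∷_) (zipWith-insertAt _∙_ u v i a b)

replicate-insertAt : ∀ n (a : A) i → replicate (suc n) a ≡ insertAt (replicate n a) i a
replicate-insertAt n       a Fin.zero    = refl
replicate-insertAt (suc n) a (Fin.suc i) = cong (a ∷_) (replicate-insertAt n a i)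

pinning : ∀ {m} → Fin (suc (suc m)) → Fin (suc m) → Vec Bool m → Vec Bool (suc (suc m))
pinning x p u = insertAt (insertAt u p true) x false

ones-pinning : ∀ {m} x p (u : Vec Bool m) → ones (pinning x p u) ≡ suc (ones u)
ones-pinning x p u = trans (ones-insertAt _ x false) (ones-insertAt u p true)

zeros-pinning : ∀ {m} x p (u : Vec Bool m) → zeros (pinning x p u) ≡ suc (zeros u)
zeros-pinning x p u = trans (zeros-insertAt _ x false) (cong suc (zeros-insertAt u p true))

module _ {C : Set} (0C : C) where

  open ≡-Reasoning

  -- Over F₂ a map is affine iff it commutes with sums of an odd number of vectors.
  IsAffine : ∀ {n r} → (Vec Bool n → Vec Bool r) → Set
  IsAffine E = ∀ ss → length ss % 2 ≡ 1 → xorSum 0C (map E ss) ≡ E (xorSum 0C ss)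

  ∘-affine : ∀ {n r t} {g : Vec Bool r → Vec Bool t} {h : Vec Bool n → Vec Bool r} →
    IsAffine g → IsAffine h → IsAffine (g ∘ h)
  ∘-affine {g = g} {h} g-affine h-affine ss odd = begin
    xorSum 0C (map (g ∘ h) ss)   ≡⟨ cong (xorSum 0C) (map-∘ ss) ⟩
    xorSum 0C (map g (map h ss)) ≡⟨ g-affine (map h ss) (trans (cong (_% 2) (length-map h ss)) odd) ⟩
    g (xorSum 0C (map h ss))     ≡⟨ cong g (h-affine ss odd) ⟩
    g (h (xorSum 0C ss))         ∎

  InSpan-∘ : ∀ {n r} (f : Sig C r) {E : Vec Bool n → Vec Bool r} → IsAffine E →
    ∀ s → InSpan 0C (f ∘ E) s → InSpan 0C f (E s)
  InSpan-∘ f {E} E-affine s (ss , ss⊆su , odd , ∑ss≡s) =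
    map E ss , map⁺ ss⊆su , trans (cong (_% 2) (length-map E ss)) odd ,
    trans (E-affine ss odd) (cong E ∑ss≡s)

  insertAt-affine : ∀ {n} (i : Fin (suc n)) b → IsAffine (λ u → insertAt u i b)
  insertAt-affine i b []ˡ ()
  insertAt-affine {n} i b (s ∷ˡ []ˡ) _ = begin
    zipWith _xor_ (insertAt s i b) (replicate (suc n) false)
      ≡⟨ cong (zipWith _xor_ (insertAt s i b)) (replicate-insertAt n false i) ⟩
    zipWith _xor_ (insertAt s i b) (insertAt (replicate n false) i false)
      ≡⟨ zipWith-insertAt _xor_ s _ i b false ⟩
    insertAt (zipWith _xor_ s (replicate n false)) i (b xor false)
      ≡⟨ cong (insertAt _ i) (xor-identityʳ b) ⟩
    insertAt (zipWith _xor_ s (replicate n false)) i b ∎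
  insertAt-affine i b (s ∷ˡ t ∷ˡ ss) odd = begin
    zipWith _xor_ (ins s) (zipWith _xor_ (ins t) (xorSum 0C (map ins ss)))
      ≡⟨ cong (zipWith _xor_ (ins s) ∘ zipWith _xor_ (ins t))
              (insertAt-affine i b ss odd) ⟩
    zipWith _xor_ (ins s) (zipWith _xor_ (ins t) (ins (xorSum 0C ss)))
      ≡⟨ cong (zipWith _xor_ (ins s)) (zipWith-insertAt _xor_ t _ i b b) ⟩
    zipWith _xor_ (ins s) (insertAt (zipWith _xor_ t (xorSum 0C ss)) i (b xor b))
      ≡⟨ zipWith-insertAt _xor_ s _ i b (b xor b) ⟩
    insertAt (xorSum 0C (s ∷ˡ t ∷ˡ ss)) i (b xor (b xor b))
      ≡⟨ cong (insertAt _ i) (trans (cong (b xor_) (xor-same b)) (xor-identityʳ b)) ⟩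
    insertAt (xorSum 0C (s ∷ˡ t ∷ˡ ss)) i b ∎
    where
    ins : Vec Bool _ → Vec Bool _
    ins u = insertAt u i b

  pinning-affine : ∀ {m} (x : Fin (suc (suc m))) p → IsAffine (pinning x p)
  pinning-affine x p = ∘-affine (insertAt-affine x false) (insertAt-affine p true)

lemma5p2 : {C : Set} (0C : C) (m : ℕ) (f : Sig C (suc (suc m)))
           (x y : Fin (suc (suc m))) (x≢y : x ≢ y) →
           IsPureUp 0C f → IsPureUp 0C (pin f x y x≢y)
lemma5p2 0C m f x y x≢y ((even , balanced) , up) = (even , balanced′) , up′
  where
  E : Vec Bool m → Vec Bool (suc (suc m))
  E = pinning x (punchOut x≢y)

  balanced′ : ∀ s → InSupport 0C (f ∘ E) s → ones s ≡ zeros s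
  balanced′ s s∈su = suc-injective
    (trans (sym (ones-pinning x _ s)) (trans (balanced (E s) s∈su) (zeros-pinning x _ s)))

  up′ : ∀ s → InSpan 0C (f ∘ E) s → zeros s ≤ ones s
  up′ s s∈span = s≤s⁻¹ (subst₂ _≤_ (zeros-pinning x _ s) (ones-pinning x _ s)
    (up (E s) (InSpan-∘ 0C f (pinning-affine 0C x _) s s∈span)))
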